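{- The operation $(I,F)\mapsto I\circ F$ is a right action of the monoid $\mathcal{P}_n$ on the power set of $[n]$, i.e. $I\circ([n])=I$ and $I\circ(F*G)=(I\circ F)\circ G$ for all $I\subseteq[n]$ and $F,G\in\mathcal{P}_n$. Moreover, $I\circ F\subseteq I$ for all $I\subseteq[n]$ and $F\in\mathcal{P}_n$.
   Context: $[n]=\{1,\dots,n\}$. $\mathcal{P}_n$ is the set of ordered set partitions $F=(F_1,\dots,F_l)$ of $[n]$ (blocks non-empty and pairwise disjoint with union $[n]$), a monoid under $F*G=(F_1\cap G_1,\dots,F_1\cap G_r,F_2\cap G_1,\dots,F_2\cap G_r,\dots,F_l\cap G_r)^\sharp$ for $G=(G_1,\dots,G_r)$, where $\sharp$ deletes empty sets; its identity is $([n])$. For $I\subseteq[n]$ and $F\in\mathcal{P}_n$ define $I\circ F=\emptyset$ if $I=\emptyset$, and otherwise $I\circ F=I\cap F_j$ where $j$ is the largest index with $I\cap F_j\ne\emptyset$. -}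

module Defs where

open import Data.Nat using (ℕ)
open import Data.Bool using (if_then_else_)
open import Data.List using (List; []; _∷_; map; concatMap; filter; foldr)
open import Data.List.Relation.Unary.All using (All)
open import Data.List.Relation.Unary.AllPairs using (AllPairs)
open import Data.Fin.Subset using (Subset; _∩_; _∪_; ⊥; ⊤; Nonempty; Empty)
open import Data.Fin.Subset.Properties using (nonempty?)
open import Relation.Nullary using (does)
open import Relation.Binary.PropositionalEquality using (_≡_)

⋃ : ∀ {n} → List (Subset n) → Subset n
⋃ = foldr _∪_ ⊥

-- A list of subsets (F₁,…,F_l) is an ordered set partition of [n]:
-- blocks non-empty, pairwise disjoint, union [n].
record IsOSP {n : ℕ} (F : List (Subset n)) : Set where
  field
    nonempty : All Nonempty F
    disjoint : AllPairs (λ A B → Empty (A ∩ B)) F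
    covers   : ⋃ F ≡ ⊤

_*_ : ∀ {n} → List (Subset n) → List (Subset n) → List (Subset n)
F * G = filter nonempty? (concatMap (λ f → map (f ∩_) G) F)

𝟙 : ∀ {n} → List (Subset n)
𝟙 = ⊤ ∷ []

-- I ∩ F_j for the largest j with I ∩ F_j ≠ ∅ (⊥ if no such j)
lastMeet : ∀ {n} → Subset n → List (Subset n) → Subset n
lastMeet I [] = ⊥
lastMeet I (f ∷ fs) =
  if does (nonempty? (lastMeet I fs)) then lastMeet I fs
  else (if does (nonempty? (I ∩ f)) then I ∩ f else ⊥)

_∘_ : ∀ {n} → Subset n → List (Subset n) → Subset n
I ∘ F = if does (nonempty? I) then lastMeet I F else ⊥

module Submission where

-- I ∘ F is the last non-empty trace I ∩ F_j, and an empty I has no such trace, so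
-- I ∘ F is just that last trace. The blocks of F * G list the refinements F_j ∩ G_k
-- F-block by F-block, so the last trace of I on F * G lies in the last F-block met
-- by I; since G covers [n], the trace I ∩ F_j meets some block of G, and the last
-- trace of I on F * G is the last trace of I ∩ F_j on G, i.e. (I ∘ F) ∘ G.

open import Defs
open import Data.Nat using (ℕ)
open import Data.Fin using (Fin)
open import Data.Bool using (if_then_else_)
open import Data.Empty using (⊥-elim)
open import Data.List using (List; []; _∷_; map; concatMap; filter; _++_)
open import Data.List.Properties using (filter-accept; filter-reject)
open import Data.Product using (_×_; _,_)
open import Data.Sum using (inj₁; inj₂)
open import Data.Fin.Subset using (Subset; _⊆_; _∩_; ⊤; ⊥; Nonempty; Empty; _∈_)
open import Data.Fin.Subset.Properties
  using (nonempty?; Empty-unique; ∉⊥; ∈⊤; p∩q⊆p; p∩q⊆q; x∈p∩q⁺; x∈p∪q⁻; ∩-assoc; ∩-identityʳ)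
open import Relation.Nullary using (Dec; does; yes; no)
open import Relation.Binary.PropositionalEquality
  using (_≡_; refl; sym; cong; cong₂; subst; module ≡-Reasoning)

open ≡-Reasoning

private
  variable
    n : ℕ

-- Defs unfolds  lastMeet I (f ∷ fs)  to  lastMeet I fs orElse (I ∩ f orElse ⊥).
infixr 5 _orElse_

_orElse_ : Subset n → Subset n → Subset n
a orElse b = if does (nonempty? a) then a else b

orElse-nonempty : {a : Subset n} (b : Subset n) → Nonempty a → a orElse b ≡ a
orElse-nonempty {a = a} b ne with nonempty? a
... | yes _ = refl
... | no e  = ⊥-elim (e ne)

orElse-empty : {a : Subset n} (b : Subset n) → Empty a → a orElse b ≡ b
orElse-empty {a = a} b e with nonempty? a
... | yes ne = ⊥-elim (e ne)
... | no _   = refl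

⊥-empty : Empty (⊥ {n})
⊥-empty (_ , x∈⊥) = ∉⊥ x∈⊥

⊆-empty : {a b : Subset n} → a ⊆ b → Empty b → Empty a
⊆-empty a⊆b e (x , x∈a) = e (x , a⊆b x∈a)

⊥-orElse : (b : Subset n) → ⊥ orElse b ≡ b
⊥-orElse b = orElse-empty b ⊥-empty

orElse-⊥ : (a : Subset n) → a orElse ⊥ ≡ a
orElse-⊥ a with nonempty? a
... | yes _ = refl
... | no e  = sym (Empty-unique e)

orElse-assoc : (a b c : Subset n) → (a orElse b) orElse c ≡ a orElse (b orElse c)
orElse-assoc a b c with nonempty? a
... | yes ne = orElse-nonempty c ne
... | no _   = refl

lastMeet-∷ : (I f : Subset n) (fs : List (Subset n)) →
             lastMeet I (f ∷ fs) ≡ lastMeet I fs orElse I ∩ f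
lastMeet-∷ I f fs = cong (lastMeet I fs orElse_) (orElse-⊥ (I ∩ f))

lastMeet-⊆ : (I : Subset n) (F : List (Subset n)) → lastMeet I F ⊆ I
lastMeet-⊆ I []       x∈⊥ = ⊥-elim (∉⊥ x∈⊥)
lastMeet-⊆ I (f ∷ fs) rewrite lastMeet-∷ I f fs with nonempty? (lastMeet I fs)
... | yes _ = lastMeet-⊆ I fs
... | no _  = p∩q⊆p I f

lastMeet-empty : {I : Subset n} (F : List (Subset n)) → Empty I → lastMeet I F ≡ ⊥
lastMeet-empty F e = Empty-unique (⊆-empty (lastMeet-⊆ _ F) e)

lastMeet-nonempty : (J : Subset n) (G : List (Subset n)) {x : Fin n} →
                    x ∈ J → x ∈ ⋃ G → Nonempty (lastMeet J G)
lastMeet-nonempty J []       x∈J x∈⊥ = ⊥-elim (∉⊥ x∈⊥)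
lastMeet-nonempty J (g ∷ gs) x∈J x∈⋃ rewrite lastMeet-∷ J g gs with nonempty? (lastMeet J gs)
... | yes ne = ne
... | no e with x∈p∪q⁻ g (⋃ gs) x∈⋃
...   | inj₁ x∈g  = _ , x∈p∩q⁺ (x∈J , x∈g)
...   | inj₂ x∈gs = ⊥-elim (e (lastMeet-nonempty J gs x∈J x∈gs))

lastMeet-nonempty-covering : (J : Subset n) (G : List (Subset n)) →
                             ⋃ G ≡ ⊤ → Nonempty J → Nonempty (lastMeet J G)
lastMeet-nonempty-covering J G cov (x , x∈J) =
  lastMeet-nonempty J G x∈J (subst (x ∈_) (sym cov) ∈⊤)

lastMeet-++ : (I : Subset n) (xs ys : List (Subset n)) →
              lastMeet I (xs ++ ys) ≡ lastMeet I ys orElse lastMeet I xs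
lastMeet-++ I []       ys = sym (orElse-⊥ (lastMeet I ys))
lastMeet-++ I (x ∷ xs) ys = begin
  lastMeet I (x ∷ xs ++ ys)                          ≡⟨ lastMeet-∷ I x (xs ++ ys) ⟩
  lastMeet I (xs ++ ys) orElse I ∩ x                 ≡⟨ cong (_orElse I ∩ x) (lastMeet-++ I xs ys) ⟩
  (lastMeet I ys orElse lastMeet I xs) orElse I ∩ x  ≡⟨ orElse-assoc _ _ _ ⟩
  lastMeet I ys orElse lastMeet I xs orElse I ∩ x    ≡⟨ cong (lastMeet I ys orElse_) (lastMeet-∷ I x xs) ⟨
  lastMeet I ys orElse lastMeet I (x ∷ xs)           ∎

lastMeet-filter-nonempty : (I : Subset n) (xs : List (Subset n)) →
                           lastMeet I (filter nonempty? xs) ≡ lastMeet I xs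
lastMeet-filter-nonempty I []       = refl
lastMeet-filter-nonempty I (x ∷ xs) = by-cases (nonempty? x)
  where
  by-cases : Dec (Nonempty x) → lastMeet I (filter nonempty? (x ∷ xs)) ≡ lastMeet I (x ∷ xs)
  by-cases (yes ne) = begin
    lastMeet I (filter nonempty? (x ∷ xs))  ≡⟨ cong (lastMeet I) (filter-accept nonempty? ne) ⟩
    lastMeet I (x ∷ filter nonempty? xs)    ≡⟨ cong (_orElse (I ∩ x orElse ⊥)) (lastMeet-filter-nonempty I xs) ⟩
    lastMeet I (x ∷ xs)                     ∎
  by-cases (no e) = begin
    lastMeet I (filter nonempty? (x ∷ xs))  ≡⟨ cong (lastMeet I) (filter-reject nonempty? e) ⟩
    lastMeet I (filter nonempty? xs)        ≡⟨ lastMeet-filter-nonempty I xs ⟩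
    lastMeet I xs                           ≡⟨ orElse-⊥ (lastMeet I xs) ⟨
    lastMeet I xs orElse ⊥                  ≡⟨ cong (lastMeet I xs orElse_) (Empty-unique (⊆-empty (p∩q⊆q I x) e)) ⟨
    lastMeet I xs orElse I ∩ x              ≡⟨ lastMeet-∷ I x xs ⟨
    lastMeet I (x ∷ xs)                     ∎

lastMeet-map-∩ : (I f : Subset n) (G : List (Subset n)) →
                 lastMeet I (map (f ∩_) G) ≡ lastMeet (I ∩ f) G
lastMeet-map-∩ I f []       = refl
lastMeet-map-∩ I f (g ∷ gs) rewrite lastMeet-map-∩ I f gs | sym (∩-assoc I f g) = refl

lastMeet-orElse : (G : List (Subset n)) → ⋃ G ≡ ⊤ → (a b : Subset n) →
                  lastMeet (a orElse b) G ≡ lastMeet a G orElse lastMeet b G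
lastMeet-orElse G cov a b with nonempty? a
... | yes ne = sym (orElse-nonempty _ (lastMeet-nonempty-covering a G cov ne))
... | no e   = begin
  lastMeet b G                        ≡⟨ ⊥-orElse (lastMeet b G) ⟨
  ⊥ orElse lastMeet b G               ≡⟨ cong (_orElse lastMeet b G) (lastMeet-empty G e) ⟨
  lastMeet a G orElse lastMeet b G    ∎

lastMeet-concatMap-∩ : (G : List (Subset n)) → ⋃ G ≡ ⊤ → (I : Subset n) (F : List (Subset n)) →
                       lastMeet I (concatMap (λ f → map (f ∩_) G) F) ≡ lastMeet (lastMeet I F) G
lastMeet-concatMap-∩ G cov I []       = sym (lastMeet-empty G ⊥-empty)
lastMeet-concatMap-∩ G cov I (f ∷ fs) = begin
  lastMeet I (map (f ∩_) G ++ concatMap (λ f → map (f ∩_) G) fs)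
    ≡⟨ lastMeet-++ I (map (f ∩_) G) _ ⟩
  lastMeet I (concatMap (λ f → map (f ∩_) G) fs) orElse lastMeet I (map (f ∩_) G)
    ≡⟨ cong₂ _orElse_ (lastMeet-concatMap-∩ G cov I fs) (lastMeet-map-∩ I f G) ⟩
  lastMeet (lastMeet I fs) G orElse lastMeet (I ∩ f) G
    ≡⟨ lastMeet-orElse G cov (lastMeet I fs) (I ∩ f) ⟨
  lastMeet (lastMeet I fs orElse I ∩ f) G
    ≡⟨ cong (λ J → lastMeet J G) (lastMeet-∷ I f fs) ⟨
  lastMeet (lastMeet I (f ∷ fs)) G
    ∎

∘-lastMeet : (I : Subset n) (F : List (Subset n)) → I ∘ F ≡ lastMeet I F
∘-lastMeet I F with nonempty? I
... | yes _ = refl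
... | no e  = sym (lastMeet-empty F e)

∘-𝟙 : (I : Subset n) → I ∘ 𝟙 ≡ I
∘-𝟙 I = begin
  I ∘ 𝟙                     ≡⟨ ∘-lastMeet I 𝟙 ⟩
  lastMeet I (⊤ ∷ [])       ≡⟨ lastMeet-∷ I ⊤ [] ⟩
  ⊥ orElse I ∩ ⊤            ≡⟨ ⊥-orElse (I ∩ ⊤) ⟩
  I ∩ ⊤                     ≡⟨ ∩-identityʳ I ⟩
  I                         ∎

∘-* : (I : Subset n) (F G : List (Subset n)) → ⋃ G ≡ ⊤ → I ∘ (F * G) ≡ (I ∘ F) ∘ G
∘-* I F G cov = begin
  I ∘ (F * G)                                     ≡⟨ ∘-lastMeet I (F * G) ⟩
  lastMeet I (F * G)                              ≡⟨ lastMeet-filter-nonempty I (concatMap (λ f → map (f ∩_) G) F) ⟩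
  lastMeet I (concatMap (λ f → map (f ∩_) G) F)   ≡⟨ lastMeet-concatMap-∩ G cov I F ⟩
  lastMeet (lastMeet I F) G                       ≡⟨ cong (λ J → lastMeet J G) (∘-lastMeet I F) ⟨
  lastMeet (I ∘ F) G                              ≡⟨ ∘-lastMeet (I ∘ F) G ⟨
  (I ∘ F) ∘ G                                     ∎

∘-⊆ : (I : Subset n) (F : List (Subset n)) → I ∘ F ⊆ I
∘-⊆ I F = subst (_⊆ I) (sym (∘-lastMeet I F)) (lastMeet-⊆ I F)

proposition2p1 : (n : ℕ) →
    ((I : Subset n) → I ∘ 𝟙 ≡ I)
    × ((I : Subset n) (F G : List (Subset n)) → IsOSP F → IsOSP G →
        I ∘ (F * G) ≡ (I ∘ F) ∘ G)
    × ((I : Subset n) (F : List (Subset n)) → IsOSP F → (I ∘ F) ⊆ I)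
proposition2p1 n =
    ∘-𝟙
  , (λ I F G _ G-osp → ∘-* I F G (IsOSP.covers G-osp))
  , (λ I F _ → ∘-⊆ I F)
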